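{- Let $G$ be a finite simple graph, let $S\in\Psi(G)$, and let $H:=G-N[S]$. Define $\Psi_S(G):=\{U\in\Psi(G): S\subseteq U\}$ and $\Omega_S(G):=\{M\in\Omega(G): S\subseteq M\}$. Then: (i) $\alpha(G)=|S|+\alpha(H)$; (ii) the map $\Phi_S:\Psi(H)\to\Psi_S(G)$, $\Phi_S(T)=S\cup T$, is a bijection; (iii) $\Omega_S(G)=\{S\cup Q: Q\in\Omega(H)\}$; (iv) $\bigcap\Omega_S(G)=S\cup\mathrm{core}(H)$ and $\bigcup\Omega_S(G)=S\cup\mathrm{corona}(H)$.
   Context: For a graph $G$ and $X\subseteq V(G)$, $N(X)$ is the set of vertices adjacent to some vertex of $X$ and $N[X]=X\cup N(X)$; $G[X]$ is the induced subgraph on $X$ and $G-X:=G[V(G)\setminus X]$. $\alpha(G)$ is the maximum size of an independent set of $G$ and $\Omega(G)$ is the family of all maximum independent sets of $G$; $\mathrm{core}(G):=\bigcap\Omega(G)$ and $\mathrm{corona}(G):=\bigcup\Omega(G)$. A set $S\subseteq V(G)$ is a local maximum independent set of $G$ if $S$ is a maximum independent set of $G[N[S]]$; $\Psi(G)$ denotes the family of all local maximum independent sets of $G$ (similarly for $H$, with neighborhoods taken in $H$). -}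

module Defs where

open import Data.Nat using (ℕ; zero; suc; _≤_; _⊔_)
open import Data.Bool using (Bool; true; false; _∧_; if_then_else_)
import Data.Bool.Properties as BoolP
open import Data.Fin using (Fin)
open import Data.Fin.Properties using (all?)
open import Data.Fin.Subset using (Subset; _∈_; _⊆_; _∪_; ∣_∣)
open import Data.Fin.Subset.Properties using (_∈?_; _⊆?_)
open import Data.Vec using (Vec; []; _∷_; lookup; tabulate)
open import Data.List using (List; [_]; _++_; map; foldr; allFin)
open import Data.Bool.ListAction using (any)
open import Data.Product using (_×_; Σ; ∃)
open import Relation.Binary.PropositionalEquality using (_≡_)
open import Relation.Nullary using (Dec; does)
open import Relation.Nullary.Decidable using (_×-dec_; _→-dec_)

record Graph (n : ℕ) : Set where
  field
    adj        : Fin n → Fin n → Bool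
    adj-sym    : ∀ x y → adj x y ≡ adj y x
    adj-irrefl : ∀ x → adj x x ≡ false

module _ {n : ℕ} (G : Graph n) where
  open Graph G

  -- All notions below are taken in the induced subgraph G[W], W ⊆ V(G).
  -- G itself is G[⊤]; G - X is G[∁ X].

  Independent : Subset n → Subset n → Set
  Independent W X = X ⊆ W × (∀ x y → x ∈ X → y ∈ X → adj x y ≡ false)

  independent? : (W X : Subset n) → Dec (Independent W X)
  independent? W X =
    (X ⊆? W) ×-dec
    all? (λ x → all? (λ y →
      (x ∈? X) →-dec ((y ∈? X) →-dec (adj x y BoolP.≟ false))))

  Nbhd : Subset n → Subset n → Subset n
  Nbhd W X = tabulate (λ y → lookup W y ∧ any (λ x → lookup X x ∧ adj x y) (allFin n))

  ClosedNbhd : Subset n → Subset n → Subset n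
  ClosedNbhd W X = X ∪ Nbhd W X

  MaxIndep : Subset n → Subset n → Set
  MaxIndep W M = Independent W M × (∀ I → Independent W I → ∣ I ∣ ≤ ∣ M ∣)

  -- S ∈ Ψ(G[W]): S ⊆ W is a maximum independent set of G[W][N[S]] = G[N[S]]
  LocalMaxIndep : Subset n → Subset n → Set
  LocalMaxIndep W S = S ⊆ W × MaxIndep (ClosedNbhd W S) S

subsets : (n : ℕ) → List (Subset n)
subsets zero    = [ [] ]
subsets (suc n) = map (false ∷_) (subsets n) ++ map (true ∷_) (subsets n)

α : {n : ℕ} → Graph n → Subset n → ℕ
α {n} G W = foldr _⊔_ 0
  (map (λ X → if does (independent? G W X) then ∣ X ∣ else 0) (subsets n))

InIntersection : {n : ℕ} → (Subset n → Set) → Fin n → Set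
InIntersection F x = ∀ M → F M → x ∈ M

InUnion : {n : ℕ} → (Subset n → Set) → Fin n → Set
InUnion F x = ∃ λ M → F M × x ∈ M

-- Write H = G - N[S]. No vertex of S has a neighbour in V(H), so S ∪ Q is independent
-- of size |S| + |Q| for every independent Q of H; conversely an independent set
-- containing S misses N(S), hence has the form S ∪ Q with Q ⊆ V(H). Local maximality
-- of S bounds the part of any independent I inside N[S] by |S|, so |I| ≤ |S| + |I ∩ V(H)|.
-- Together these show that S ∪ Q is a maximum independent set of G[W] exactly when Q is
-- one of G[W ∩ V(H)], for every W ⊇ S. Taking W = V(G) gives (i), (iii) and (iv); taking
-- W = N[S ∪ T], whose trace on V(H) is the closed neighbourhood of T in H, gives (ii).
module Submission where

open import Defs
open import Data.Nat using (ℕ; suc; _+_; _≤_; _⊔_)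
open import Data.Nat.Properties using (≤-antisym; ≤-trans; m≤m⊔n; m≤n⊔m; ⊔-sel; +-suc; +-monoˡ-≤; +-monoʳ-≤; +-cancelˡ-≤; module ≤-Reasoning)
open import Data.Bool using (true; false; _∧_; if_then_else_)
open import Data.Bool.Properties using (T-≡; T-∧)
open import Data.Bool.ListAction using (any)
open import Data.Fin.Subset using (Subset; _∈_; _∉_; _⊆_; _∪_; _∩_; ∁; ⊤; ⊥; ∣_∣)
open import Data.Fin.Subset.Properties using (_∈?_; ∈⊤; ⊆⊤; ∉⊥; ⊥⊆; ∣⊥∣≡0; ⊆-antisym; p⊆p∪q; q⊆p∪q; x∈p∪q⁺; x∈p∪q⁻; p∩q⊆p; p∩q⊆q; x∈p∩q⁺; x∈p∩q⁻; x∈∁p⇒x∉p; x∉p⇒x∈∁p; ∩-identityˡ; ∩-identityʳ; ∪-inverseʳ; ∩-distribˡ-∪)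
open import Data.Vec using ([]; _∷_; here; there; lookup)
open import Data.Vec.Properties using (lookup∘tabulate; []=⇒lookup; lookup⇒[]=)
open import Data.List using (map; foldr; allFin) renaming (_∷_ to _∷ₗ_; [] to []ₗ)
open import Data.List.Relation.Unary.Any using (satisfied) renaming (here to hereₗ; there to thereₗ)
open import Data.List.Relation.Unary.Any.Properties using (any⁺; any⁻)
open import Data.List.Membership.Propositional using (lose) renaming (_∈_ to _∈ₗ_)
open import Data.List.Membership.Propositional.Properties using (∈-map⁺; ∈-map⁻; ∈-++⁺ˡ; ∈-++⁺ʳ; ∈-allFin)
open import Data.Product using (_×_; ∃; _,_; proj₁; proj₂)
open import Data.Sum using (_⊎_; inj₁; inj₂; map₂; [_,_]′)
open import Data.Empty using (⊥-elim)
open import Function using (_∘_; id)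
open import Function.Bundles using (_⇔_; mk⇔; Equivalence)
open import Relation.Nullary using (Dec; yes; no; does; contradiction)
open import Relation.Nullary.Decidable using (dec-true)
open import Relation.Binary.PropositionalEquality using (_≡_; refl; sym; trans; cong; cong₂; subst; module ≡-Reasoning)

open Equivalence using (to; from)

≤foldr-⊔ : ∀ {m ms} → m ∈ₗ ms → m ≤ foldr _⊔_ 0 ms
≤foldr-⊔ {ms = m ∷ₗ ms} (hereₗ refl) = m≤m⊔n m _
≤foldr-⊔ {ms = m ∷ₗ ms} (thereₗ m′∈ms) = ≤-trans (≤foldr-⊔ m′∈ms) (m≤n⊔m m _)

foldr-⊔-∈ : ∀ ms → foldr _⊔_ 0 ms ∈ₗ 0 ∷ₗ ms
foldr-⊔-∈ []ₗ = hereₗ refl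
foldr-⊔-∈ (m ∷ₗ ms) with ⊔-sel m (foldr _⊔_ 0 ms) | foldr-⊔-∈ ms
... | inj₁ ⊔≡m | _ = thereₗ (hereₗ ⊔≡m)
... | inj₂ ⊔≡max | hereₗ max≡0 = hereₗ (trans ⊔≡max max≡0)
... | inj₂ ⊔≡max | thereₗ max∈ms = thereₗ (thereₗ (subst (_∈ₗ ms) (sym ⊔≡max) max∈ms))

∈-subsets : ∀ {n} (X : Subset n) → X ∈ₗ subsets n
∈-subsets [] = hereₗ refl
∈-subsets {suc n} (false ∷ X) = ∈-++⁺ˡ (∈-map⁺ (false ∷_) (∈-subsets X))
∈-subsets {suc n} (true ∷ X) = ∈-++⁺ʳ (map (false ∷_) (subsets n)) (∈-map⁺ (true ∷_) (∈-subsets X))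

∣p∪q∣≡∣p∣+∣q∣ : ∀ {n} (p q : Subset n) → (∀ {x} → x ∈ p → x ∉ q) → ∣ p ∪ q ∣ ≡ ∣ p ∣ + ∣ q ∣
∣p∪q∣≡∣p∣+∣q∣ [] [] _ = refl
∣p∪q∣≡∣p∣+∣q∣ (true ∷ p) (true ∷ q) disjoint = ⊥-elim (disjoint here here)
∣p∪q∣≡∣p∣+∣q∣ (true ∷ p) (false ∷ q) disjoint =
  cong suc (∣p∪q∣≡∣p∣+∣q∣ p q (λ x∈p → disjoint (there x∈p) ∘ there))
∣p∪q∣≡∣p∣+∣q∣ (false ∷ p) (true ∷ q) disjoint =
  trans (cong suc (∣p∪q∣≡∣p∣+∣q∣ p q (λ x∈p → disjoint (there x∈p) ∘ there))) (sym (+-suc _ _))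
∣p∪q∣≡∣p∣+∣q∣ (false ∷ p) (false ∷ q) disjoint =
  ∣p∪q∣≡∣p∣+∣q∣ p q (λ x∈p → disjoint (there x∈p) ∘ there)

∣p∣≡∣p∩q∣+∣p∩∁q∣ : ∀ {n} (p q : Subset n) → ∣ p ∣ ≡ ∣ p ∩ q ∣ + ∣ p ∩ ∁ q ∣
∣p∣≡∣p∩q∣+∣p∩∁q∣ p q = begin
  ∣ p ∣                 ≡⟨ cong ∣_∣ (∩-identityʳ p) ⟨
  ∣ p ∩ ⊤ ∣             ≡⟨ cong (λ r → ∣ p ∩ r ∣) (∪-inverseʳ q) ⟨
  ∣ p ∩ (q ∪ ∁ q) ∣     ≡⟨ cong ∣_∣ (∩-distribˡ-∪ p q (∁ q)) ⟩
  ∣ p ∩ q ∪ p ∩ ∁ q ∣   ≡⟨ ∣p∪q∣≡∣p∣+∣q∣ (p ∩ q) (p ∩ ∁ q) disjoint ⟩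
  ∣ p ∩ q ∣ + ∣ p ∩ ∁ q ∣ ∎
  where
  open ≡-Reasoning
  disjoint : ∀ {x} → x ∈ p ∩ q → x ∉ p ∩ ∁ q
  disjoint x∈p∩q x∈p∩∁q = x∈∁p⇒x∉p (proj₂ (x∈p∩q⁻ p (∁ q) x∈p∩∁q)) (proj₂ (x∈p∩q⁻ p q x∈p∩q))

∪-lub : ∀ {n} {p q r : Subset n} → p ⊆ r → q ⊆ r → p ∪ q ⊆ r
∪-lub {p = p} {q} p⊆r q⊆r = [ p⊆r , q⊆r ]′ ∘ x∈p∪q⁻ p q

∩-glb : ∀ {n} {p q r : Subset n} → r ⊆ p → r ⊆ q → r ⊆ p ∩ q
∩-glb r⊆p r⊆q x∈r = x∈p∩q⁺ (r⊆p x∈r , r⊆q x∈r)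

x∈p∪q⇒x∉p⇒x∈q : ∀ {n} (p q : Subset n) {x} → x ∈ p ∪ q → x ∉ p → x ∈ q
x∈p∪q⇒x∉p⇒x∈q p q x∈p∪q x∉p = [ (λ x∈p → contradiction x∈p x∉p) , id ]′ (x∈p∪q⁻ p q x∈p∪q)

∪-cancelˡ : ∀ {n} {S T T′ : Subset n} → (∀ {x} → x ∈ T → x ∉ S) → (∀ {x} → x ∈ T′ → x ∉ S) →
            S ∪ T ≡ S ∪ T′ → T ≡ T′
∪-cancelˡ {S = S} T∉S T′∉S S∪T≡S∪T′ = ⊆-antisym (⊆-of T∉S S∪T≡S∪T′) (⊆-of T′∉S (sym S∪T≡S∪T′))
  where
  ⊆-of : ∀ {T T′} → (∀ {x} → x ∈ T → x ∉ S) → S ∪ T ≡ S ∪ T′ → T ⊆ T′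
  ⊆-of {T} {T′} T∉S eq x∈T = x∈p∪q⇒x∉p⇒x∈q S T′ (subst (_ ∈_) eq (q⊆p∪q S T x∈T)) (T∉S x∈T)

module _ {n : ℕ} {S : Subset n} {F F′ : Subset n → Set}
         (F⇔S∪F′ : ∀ M → F M ⇔ (∃ λ Q → F′ Q × M ≡ S ∪ Q)) where

  InIntersection-S∪ : ∀ x → InIntersection F x ⇔ (x ∈ S ⊎ InIntersection F′ x)
  InIntersection-S∪ x = mk⇔ ⇒ ⇐
    where
    ⇒ : InIntersection F x → x ∈ S ⊎ InIntersection F′ x
    ⇒ x∈⋂F with x ∈? S
    ... | yes x∈S = inj₁ x∈S
    ... | no x∉S = inj₂ λ Q F′Q →
      x∈p∪q⇒x∉p⇒x∈q S Q (x∈⋂F (S ∪ Q) (from (F⇔S∪F′ (S ∪ Q)) (Q , F′Q , refl))) x∉S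
    ⇐ : x ∈ S ⊎ InIntersection F′ x → InIntersection F x
    ⇐ x∈S∪⋂F′ M FM with to (F⇔S∪F′ M) FM
    ... | Q , F′Q , refl = x∈p∪q⁺ (map₂ (λ x∈⋂F′ → x∈⋂F′ Q F′Q) x∈S∪⋂F′)

  InUnion-S∪ : ∃ F′ → ∀ x → InUnion F x ⇔ (x ∈ S ⊎ InUnion F′ x)
  InUnion-S∪ (Q₀ , F′Q₀) x = mk⇔ ⇒ ⇐
    where
    ⇒ : InUnion F x → x ∈ S ⊎ InUnion F′ x
    ⇒ (M , FM , x∈M) with to (F⇔S∪F′ M) FM
    ... | Q , F′Q , refl = map₂ (λ x∈Q → Q , F′Q , x∈Q) (x∈p∪q⁻ S Q x∈M)
    ⇐ : x ∈ S ⊎ InUnion F′ x → InUnion F x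
    ⇐ (inj₁ x∈S) = S ∪ Q₀ , from (F⇔S∪F′ (S ∪ Q₀)) (Q₀ , F′Q₀ , refl) , p⊆p∪q Q₀ x∈S
    ⇐ (inj₂ (Q , F′Q , x∈Q)) = S ∪ Q , from (F⇔S∪F′ (S ∪ Q)) (Q , F′Q , refl) , q⊆p∪q S Q x∈Q

module _ {n : ℕ} (G : Graph n) where
  open Graph G

  EdgeFree : Subset n → Set
  EdgeFree X = ∀ x y → x ∈ X → y ∈ X → adj x y ≡ false

  edgeFree-⊆ : ∀ {X Y} → X ⊆ Y → EdgeFree Y → EdgeFree X
  edgeFree-⊆ X⊆Y Y-free x y x∈X y∈X = Y-free x y (X⊆Y x∈X) (X⊆Y y∈X)

  ∈Nbhd⁺ : ∀ {W X x y} → y ∈ W → x ∈ X → adj x y ≡ true → y ∈ Nbhd G W X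
  ∈Nbhd⁺ {W} {X} {x} {y} y∈W x∈X xy = lookup⇒[]= y _ (begin
    lookup (Nbhd G W X) y                                    ≡⟨ lookup∘tabulate _ y ⟩
    lookup W y ∧ any (λ z → lookup X z ∧ adj z y) (allFin n) ≡⟨ cong₂ _∧_ ([]=⇒lookup y∈W) some-neighbour ⟩
    true                                                     ∎)
    where
    open ≡-Reasoning
    some-neighbour : any (λ z → lookup X z ∧ adj z y) (allFin n) ≡ true
    some-neighbour = to T-≡ (any⁺ _ (lose (∈-allFin x) (from T-≡ (cong₂ _∧_ ([]=⇒lookup x∈X) xy))))

  ∈Nbhd⁻ : ∀ {W X y} → y ∈ Nbhd G W X → y ∈ W × ∃ λ x → x ∈ X × adj x y ≡ true
  ∈Nbhd⁻ {W} {X} {y} y∈N =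
    let y∈W , some-neighbour = to T-∧ (from T-≡ (trans (sym (lookup∘tabulate _ y)) ([]=⇒lookup y∈N)))
        x , x∈X∧xy = satisfied (any⁻ _ (allFin n) some-neighbour)
        x∈X , xy = to T-∧ x∈X∧xy
    in lookup⇒[]= y W (to T-≡ y∈W) , x , lookup⇒[]= x X (to T-≡ x∈X) , to T-≡ xy

  independentSize : Subset n → Subset n → ℕ
  independentSize W X = if does (independent? G W X) then ∣ X ∣ else 0

  ∣I∣≤α : ∀ {W I} → Independent G W I → ∣ I ∣ ≤ α G W
  ∣I∣≤α {W} {I} I-ind =
    subst (_≤ α G W) size≡∣I∣ (≤foldr-⊔ (∈-map⁺ (independentSize W) (∈-subsets I)))
    where
    size≡∣I∣ : independentSize W I ≡ ∣ I ∣
    size≡∣I∣ = cong (λ b → if b then ∣ I ∣ else 0) (dec-true (independent? G W I) I-ind)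

  α-attained : ∀ W → ∃ λ X → Independent G W X × ∣ X ∣ ≡ α G W
  α-attained W = attained (foldr-⊔-∈ (map (independentSize W) (subsets n)))
    where
    Attained : Set
    Attained = ∃ λ X → Independent G W X × ∣ X ∣ ≡ α G W
    by-∅ : α G W ≡ 0 → Attained
    by-∅ α≡0 = ⊥ , (⊥⊆ , λ x y x∈⊥ → contradiction x∈⊥ ∉⊥) , trans (∣⊥∣≡0 n) (sym α≡0)
    by-size : ∀ X (X-ind? : Dec (Independent G W X)) →
              α G W ≡ (if does X-ind? then ∣ X ∣ else 0) → Attained
    by-size X (yes X-ind) α≡∣X∣ = X , X-ind , sym α≡∣X∣
    by-size X (no _) = by-∅
    attained : α G W ∈ₗ 0 ∷ₗ map (independentSize W) (subsets n) → Attained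
    attained (hereₗ α≡0) = by-∅ α≡0
    attained (thereₗ α∈sizes) =
      let X , _ , α≡size = ∈-map⁻ (independentSize W) α∈sizes
      in by-size X (independent? G W X) α≡size

  Ω-nonempty : ∀ W → ∃ (MaxIndep G W)
  Ω-nonempty W =
    let X , X-ind , ∣X∣≡α = α-attained W
    in X , X-ind , λ I I-ind → subst (∣ I ∣ ≤_) (sym ∣X∣≡α) (∣I∣≤α I-ind)

  α≡∣M∣ : ∀ {W M} → MaxIndep G W M → α G W ≡ ∣ M ∣
  α≡∣M∣ {W} (M-ind , M-max) =
    let X , X-ind , ∣X∣≡α = α-attained W
    in ≤-antisym (subst (_≤ _) ∣X∣≡α (M-max X X-ind)) (∣I∣≤α M-ind)

  edgeFree⇒∉Nbhd : ∀ {W M S x} → EdgeFree M → S ⊆ M → x ∈ M → x ∉ Nbhd G W S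
  edgeFree⇒∉Nbhd {W} M-free S⊆M x∈M x∈N =
    let _ , s , s∈S , sx = ∈Nbhd⁻ {W} x∈N
    in contradiction (trans (sym sx) (M-free s _ (S⊆M s∈S) x∈M)) λ ()

module Remainder {n : ℕ} (G : Graph n) (S : Subset n) where
  open Graph G

  N[S] : Subset n
  N[S] = ClosedNbhd G ⊤ S

  VH : Subset n
  VH = ∁ N[S]

  ∈VH⇒∉S : ∀ {x} → x ∈ VH → x ∉ S
  ∈VH⇒∉S x∈VH = x∈∁p⇒x∉p x∈VH ∘ p⊆p∪q _

  S-VH-nonadjacent : ∀ {s x} → s ∈ S → x ∈ VH → adj s x ≡ false
  S-VH-nonadjacent {s} {x} s∈S x∈VH with adj s x in sx
  ... | false = refl
  ... | true = contradiction (q⊆p∪q S _ (∈Nbhd⁺ G ∈⊤ s∈S sx)) (x∈∁p⇒x∉p x∈VH)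

  S∪-edgeFree : ∀ {Q} → EdgeFree G S → EdgeFree G Q → Q ⊆ VH → EdgeFree G (S ∪ Q)
  S∪-edgeFree {Q} S-free Q-free Q⊆VH x y x∈S∪Q y∈S∪Q with x∈p∪q⁻ S Q x∈S∪Q | x∈p∪q⁻ S Q y∈S∪Q
  ... | inj₁ x∈S | inj₁ y∈S = S-free x y x∈S y∈S
  ... | inj₁ x∈S | inj₂ y∈Q = S-VH-nonadjacent x∈S (Q⊆VH y∈Q)
  ... | inj₂ x∈Q | inj₁ y∈S = trans (adj-sym x y) (S-VH-nonadjacent y∈S (Q⊆VH x∈Q))
  ... | inj₂ x∈Q | inj₂ y∈Q = Q-free x y x∈Q y∈Q

  ∣S∪Q∣≡∣S∣+∣Q∣ : ∀ {Q} → Q ⊆ VH → ∣ S ∪ Q ∣ ≡ ∣ S ∣ + ∣ Q ∣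
  ∣S∪Q∣≡∣S∣+∣Q∣ {Q} Q⊆VH = ∣p∪q∣≡∣p∣+∣q∣ S Q (λ x∈S x∈Q → ∈VH⇒∉S (Q⊆VH x∈Q) x∈S)

  S∪-injective : ∀ {T T′} → T ⊆ VH → T′ ⊆ VH → S ∪ T ≡ S ∪ T′ → T ≡ T′
  S∪-injective T⊆VH T′⊆VH = ∪-cancelˡ (∈VH⇒∉S ∘ T⊆VH) (∈VH⇒∉S ∘ T′⊆VH)

  ≡S∪∩VH : ∀ {M} → EdgeFree G M → S ⊆ M → M ≡ S ∪ M ∩ VH
  ≡S∪∩VH {M} M-free S⊆M = ⊆-antisym ⊆S∪∩VH (∪-lub S⊆M (p∩q⊆p M VH))
    where
    ⊆S∪∩VH : M ⊆ S ∪ M ∩ VH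
    ⊆S∪∩VH {x} x∈M with x ∈? S
    ... | yes x∈S = p⊆p∪q _ x∈S
    ... | no x∉S = q⊆p∪q S _ (x∈p∩q⁺ (x∈M , x∉p⇒x∈∁p x∉N[S]))
      where
      x∉N[S] : x ∉ N[S]
      x∉N[S] = [ x∉S , edgeFree⇒∉Nbhd G {⊤} M-free S⊆M x∈M ]′ ∘ x∈p∪q⁻ S _

  ∈Nbhd[S∪T]⇒∈Nbhd[T] : ∀ {T x} → x ∈ VH → x ∈ Nbhd G ⊤ (S ∪ T) → x ∈ Nbhd G VH T
  ∈Nbhd[S∪T]⇒∈Nbhd[T] {T} x∈VH x∈N with ∈Nbhd⁻ G {⊤} x∈N
  ... | _ , y , y∈S∪T , yx with x∈p∪q⁻ S T y∈S∪T
  ...   | inj₁ y∈S = contradiction (trans (sym yx) (S-VH-nonadjacent y∈S x∈VH)) λ ()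
  ...   | inj₂ y∈T = ∈Nbhd⁺ G x∈VH y∈T yx

  ClosedNbhd[S∪T]∩VH : ∀ {T} → T ⊆ VH → ClosedNbhd G ⊤ (S ∪ T) ∩ VH ≡ ClosedNbhd G VH T
  ClosedNbhd[S∪T]∩VH {T} T⊆VH = ⊆-antisym ⊆N[T] ⊇N[T]
    where
    ⊆N[T] : ClosedNbhd G ⊤ (S ∪ T) ∩ VH ⊆ ClosedNbhd G VH T
    ⊆N[T] x∈N∩VH =
      let x∈N , x∈VH = x∈p∩q⁻ _ VH x∈N∩VH
          x∉S = ∈VH⇒∉S x∈VH
      in [ (λ x∈S∪T → p⊆p∪q _ (x∈p∪q⇒x∉p⇒x∈q S T x∈S∪T x∉S))
         , q⊆p∪q T _ ∘ ∈Nbhd[S∪T]⇒∈Nbhd[T] x∈VH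
         ]′ (x∈p∪q⁻ (S ∪ T) _ x∈N)
    ⊇N[T] : ClosedNbhd G VH T ⊆ ClosedNbhd G ⊤ (S ∪ T) ∩ VH
    ⊇N[T] x∈N[T] with x∈p∪q⁻ T _ x∈N[T]
    ... | inj₁ x∈T = x∈p∩q⁺ (p⊆p∪q _ (q⊆p∪q S T x∈T) , T⊆VH x∈T)
    ... | inj₂ x∈N with ∈Nbhd⁻ G {VH} x∈N
    ...   | x∈VH , y , y∈T , yx =
      x∈p∩q⁺ (q⊆p∪q (S ∪ T) _ (∈Nbhd⁺ G ∈⊤ (q⊆p∪q S T y∈T) yx) , x∈VH)

  module Transfer (S∈Ψ : LocalMaxIndep G ⊤ S) where
    S-free : EdgeFree G S
    S-free = proj₂ (proj₁ (proj₂ S∈Ψ))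

    ∣I∣≤∣S∣+∣I∩VH∣ : ∀ {I} → EdgeFree G I → ∣ I ∣ ≤ ∣ S ∣ + ∣ I ∩ VH ∣
    ∣I∣≤∣S∣+∣I∩VH∣ {I} I-free = begin
      ∣ I ∣                     ≡⟨ ∣p∣≡∣p∩q∣+∣p∩∁q∣ I N[S] ⟩
      ∣ I ∩ N[S] ∣ + ∣ I ∩ VH ∣ ≤⟨ +-monoˡ-≤ ∣ I ∩ VH ∣ (proj₂ (proj₂ S∈Ψ) (I ∩ N[S]) I∩N[S]-ind) ⟩
      ∣ S ∣ + ∣ I ∩ VH ∣        ∎
      where
      open ≤-Reasoning
      I∩N[S]-ind : Independent G N[S] (I ∩ N[S])
      I∩N[S]-ind = p∩q⊆q I N[S] , edgeFree-⊆ G (p∩q⊆p I N[S]) I-free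

    S∪-maxIndep⇔ : ∀ {W W′ Q} → S ⊆ W → W ∩ VH ≡ W′ → Q ⊆ VH →
                   MaxIndep G W (S ∪ Q) ⇔ MaxIndep G W′ Q
    S∪-maxIndep⇔ {W} {_} {Q} S⊆W refl Q⊆VH = mk⇔ ⇒ ⇐
      where
      open ≤-Reasoning
      ⇒ : MaxIndep G W (S ∪ Q) → MaxIndep G (W ∩ VH) Q
      ⇒ ((S∪Q⊆W , S∪Q-free) , S∪Q-max) =
        (∩-glb (S∪Q⊆W ∘ q⊆p∪q S Q) Q⊆VH , edgeFree-⊆ G (q⊆p∪q S Q) S∪Q-free) , Q-max
        where
        Q-max : ∀ I → Independent G (W ∩ VH) I → ∣ I ∣ ≤ ∣ Q ∣
        Q-max I (I⊆W∩VH , I-free) = +-cancelˡ-≤ ∣ S ∣ _ _ (begin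
          ∣ S ∣ + ∣ I ∣ ≡⟨ ∣S∪Q∣≡∣S∣+∣Q∣ I⊆VH ⟨
          ∣ S ∪ I ∣     ≤⟨ S∪Q-max (S ∪ I) S∪I-ind ⟩
          ∣ S ∪ Q ∣     ≡⟨ ∣S∪Q∣≡∣S∣+∣Q∣ Q⊆VH ⟩
          ∣ S ∣ + ∣ Q ∣ ∎)
          where
          I⊆VH : I ⊆ VH
          I⊆VH = p∩q⊆q W VH ∘ I⊆W∩VH
          S∪I-ind : Independent G W (S ∪ I)
          S∪I-ind = ∪-lub S⊆W (p∩q⊆p W VH ∘ I⊆W∩VH) , S∪-edgeFree S-free I-free I⊆VH
      ⇐ : MaxIndep G (W ∩ VH) Q → MaxIndep G W (S ∪ Q)
      ⇐ ((Q⊆W∩VH , Q-free) , Q-max) =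
        (∪-lub S⊆W (p∩q⊆p W VH ∘ Q⊆W∩VH) , S∪-edgeFree S-free Q-free Q⊆VH) , S∪Q-max
        where
        S∪Q-max : ∀ I → Independent G W I → ∣ I ∣ ≤ ∣ S ∪ Q ∣
        S∪Q-max I (I⊆W , I-free) = begin
          ∣ I ∣              ≤⟨ ∣I∣≤∣S∣+∣I∩VH∣ I-free ⟩
          ∣ S ∣ + ∣ I ∩ VH ∣ ≤⟨ +-monoʳ-≤ ∣ S ∣ (Q-max (I ∩ VH) I∩VH-ind) ⟩
          ∣ S ∣ + ∣ Q ∣      ≡⟨ ∣S∪Q∣≡∣S∣+∣Q∣ Q⊆VH ⟨
          ∣ S ∪ Q ∣          ∎
          where
          I∩VH-ind : Independent G (W ∩ VH) (I ∩ VH)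
          I∩VH-ind = ∩-glb (I⊆W ∘ p∩q⊆p I VH) (p∩q⊆q I VH) , edgeFree-⊆ G (p∩q⊆p I VH) I-free

    Ω-S⇔ : ∀ M → (MaxIndep G ⊤ M × S ⊆ M) ⇔ (∃ λ Q → MaxIndep G VH Q × M ≡ S ∪ Q)
    Ω-S⇔ M = mk⇔ ⇒ ⇐
      where
      ⇒ : MaxIndep G ⊤ M × S ⊆ M → ∃ λ Q → MaxIndep G VH Q × M ≡ S ∪ Q
      ⇒ (M-max , S⊆M) =
        let M≡S∪Q = ≡S∪∩VH (proj₂ (proj₁ M-max)) S⊆M
            S∪Q-max = subst (MaxIndep G ⊤) M≡S∪Q M-max
        in M ∩ VH , to (S∪-maxIndep⇔ ⊆⊤ (∩-identityˡ VH) (p∩q⊆q M VH)) S∪Q-max , M≡S∪Q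
      ⇐ : (∃ λ Q → MaxIndep G VH Q × M ≡ S ∪ Q) → MaxIndep G ⊤ M × S ⊆ M
      ⇐ (Q , Q-max , refl) = from (S∪-maxIndep⇔ ⊆⊤ (∩-identityˡ VH) (proj₁ (proj₁ Q-max))) Q-max , p⊆p∪q Q

    Ψ-S⇔ : ∀ U → (LocalMaxIndep G ⊤ U × S ⊆ U) ⇔ (∃ λ T → LocalMaxIndep G VH T × U ≡ S ∪ T)
    Ψ-S⇔ U = mk⇔ ⇒ ⇐
      where
      S⊆N[S∪T] : ∀ {T} → S ⊆ ClosedNbhd G ⊤ (S ∪ T)
      S⊆N[S∪T] {T} = p⊆p∪q _ ∘ p⊆p∪q T
      ⇒ : LocalMaxIndep G ⊤ U × S ⊆ U → ∃ λ T → LocalMaxIndep G VH T × U ≡ S ∪ T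
      ⇒ ((_ , U-max) , S⊆U) =
        let U≡S∪T = ≡S∪∩VH (proj₂ (proj₁ U-max)) S⊆U
            T⊆VH = p∩q⊆q U VH
            S∪T-max = subst (λ X → MaxIndep G (ClosedNbhd G ⊤ X) X) U≡S∪T U-max
        in U ∩ VH , (T⊆VH , to (S∪-maxIndep⇔ S⊆N[S∪T] (ClosedNbhd[S∪T]∩VH T⊆VH) T⊆VH) S∪T-max) , U≡S∪T
      ⇐ : (∃ λ T → LocalMaxIndep G VH T × U ≡ S ∪ T) → LocalMaxIndep G ⊤ U × S ⊆ U
      ⇐ (T , (T⊆VH , T-max) , refl) =
        (⊆⊤ , from (S∪-maxIndep⇔ S⊆N[S∪T] (ClosedNbhd[S∪T]∩VH T⊆VH) T⊆VH) T-max) , p⊆p∪q T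

    α≡∣S∣+α[H] : α G ⊤ ≡ ∣ S ∣ + α G VH
    α≡∣S∣+α[H] =
      let Q , Q-max = Ω-nonempty G VH
      in begin
        α G ⊤          ≡⟨ α≡∣M∣ G (proj₁ (from (Ω-S⇔ (S ∪ Q)) (Q , Q-max , refl))) ⟩
        ∣ S ∪ Q ∣      ≡⟨ ∣S∪Q∣≡∣S∣+∣Q∣ (proj₁ (proj₁ Q-max)) ⟩
        ∣ S ∣ + ∣ Q ∣  ≡⟨ cong (∣ S ∣ +_) (α≡∣M∣ G Q-max) ⟨
        ∣ S ∣ + α G VH ∎
      where open ≡-Reasoning

proposition3p6 : {n : ℕ} (G : Graph n) (S : Subset n) →
    LocalMaxIndep G ⊤ S →
    let VH = ∁ (ClosedNbhd G ⊤ S) in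
    -- (i) α(G) = |S| + α(H)
    (α G ⊤ ≡ ∣ S ∣ + α G VH)
    -- (ii) Φ_S : Ψ(H) → Ψ_S(G), T ↦ S ∪ T, is a bijection
    × ((∀ T → LocalMaxIndep G VH T → LocalMaxIndep G ⊤ (S ∪ T) × S ⊆ (S ∪ T))
      × (∀ T T′ → LocalMaxIndep G VH T → LocalMaxIndep G VH T′ → S ∪ T ≡ S ∪ T′ → T ≡ T′)
      × (∀ U → LocalMaxIndep G ⊤ U → S ⊆ U → ∃ λ T → LocalMaxIndep G VH T × S ∪ T ≡ U))
    -- (iii) Ω_S(G) = { S ∪ Q : Q ∈ Ω(H) }
    × (∀ M → (MaxIndep G ⊤ M × S ⊆ M) ⇔ (∃ λ Q → MaxIndep G VH Q × M ≡ S ∪ Q))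
    -- (iv) ⋂ Ω_S(G) = S ∪ core(H) and ⋃ Ω_S(G) = S ∪ corona(H)
    × (∀ x → InIntersection (λ M → MaxIndep G ⊤ M × S ⊆ M) x
             ⇔ (x ∈ S ⊎ InIntersection (MaxIndep G VH) x))
    × (∀ x → InUnion (λ M → MaxIndep G ⊤ M × S ⊆ M) x
             ⇔ (x ∈ S ⊎ InUnion (MaxIndep G VH) x))
proposition3p6 G S S∈Ψ =
    α≡∣S∣+α[H]
  , ( (λ T T∈Ψ → from (Ψ-S⇔ (S ∪ T)) (T , T∈Ψ , refl))
    , (λ T T′ T∈Ψ T′∈Ψ → S∪-injective (proj₁ T∈Ψ) (proj₁ T′∈Ψ))
    , (λ U U∈Ψ S⊆U → let T , T∈Ψ , U≡S∪T = to (Ψ-S⇔ U) (U∈Ψ , S⊆U) in T , T∈Ψ , sym U≡S∪T) )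
  , Ω-S⇔
  , InIntersection-S∪ Ω-S⇔
  , InUnion-S∪ Ω-S⇔ (Ω-nonempty G VH)
  where
  open Remainder G S
  open Transfer S∈Ψ
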